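{- For every $n\ge1$ and every up-down permutation $\pi$ of $[n]$, the number of cycles of $f(\pi)$ equals $\mathrm{st}(\pi)$, the length of the min-max subsequence of $\pi$.
   Context: For a finite set $A=\{a_1<\dots<a_n\}$ of positive integers and a permutation $\sigma$ of $A$ in one-line notation, the switch $\overline{\sigma}$ is obtained by replacing each entry $a_i$ by $a_{n+1-i}$. An up-down permutation of $A$ is a one-line arrangement $\pi_1\cdots\pi_n$ with $\pi_1<\pi_2>\pi_3<\cdots$. The map $f$ is defined recursively on up-down permutations of finite sets $A$: $f$ of the empty word is the empty product (identity), and if $\pi_k=\min A$ then $f(\pi)=(\pi_k,\pi_{k-1},\dots,\pi_1)\,f(\overline{\pi_{k+1}\pi_{k+2}\cdots\pi_n})$, a product of disjoint cycles giving a permutation of $A$. The min-max subsequence of $\pi=\pi_1\cdots\pi_n$ is $\pi_{i_1}\pi_{i_2}\cdots\pi_{i_k}$ where $\pi_{i_1}$ is the smallest entry of $\pi$, $\pi_{i_2}$ the largest entry to the right of position $i_1$, $\pi_{i_3}$ the smallest entry to the right of position $i_2$, and so on, alternating, until $i_k=n$; $\mathrm{st}(\pi)=k$. -}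

module Defs where

open import Data.Bool using (Bool; true; false; not; if_then_else_)
open import Data.Nat using (ℕ; zero; suc; _<_; _≤_; _≤ᵇ_; _≡ᵇ_; _⊔_; _⊓_)
open import Data.List using (List; []; _∷_; length; map; reverse; upTo; filter; foldr; zip)
open import Data.Product using (_×_; _,_)
open import Data.Unit using (⊤)
open import Function using (_∘_; id)
open import Relation.Nullary.Decidable using (does)

-- Words (one-line notation) are lists of positive integers.
Word : Set
Word = List ℕ

range1 : ℕ → List ℕ
range1 n = map suc (upTo n)

-- Up-down (alternating) condition  π₁ < π₂ > π₃ < ...
-- Alt true  : next comparison must be an ascent; Alt false : a descent.
Alt : Bool → Word → Set
Alt b []            = ⊤
Alt b (x ∷ [])      = ⊤
Alt true  (x ∷ y ∷ r) = x < y × Alt false (y ∷ r)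
Alt false (x ∷ y ∷ r) = y < x × Alt true  (y ∷ r)

UpDown : Word → Set
UpDown = Alt true

insert : ℕ → List ℕ → List ℕ
insert x [] = x ∷ []
insert x (y ∷ ys) = if x ≤ᵇ y then x ∷ y ∷ ys else y ∷ insert x ys

sort : List ℕ → List ℕ
sort = foldr insert []

assoc : List (ℕ × ℕ) → ℕ → ℕ
assoc [] x = x
assoc ((a , b) ∷ r) x = if a ≡ᵇ x then b else assoc r x

-- switch: with A = {a₁ < ... < aₘ} the set of entries, replace aᵢ by a_{m+1-i}
switch : Word → Word
switch w = map (assoc (zip s (reverse s))) w
  where s = sort w

minL : ℕ → List ℕ → ℕ
minL = foldr _⊓_

maxL : ℕ → List ℕ → ℕ
maxL = foldr _⊔_

splitAt≡ : ℕ → Word → Word × Word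
splitAt≡ m [] = [] , []
splitAt≡ m (x ∷ xs) with m ≡ᵇ x
... | true = [] , xs
... | false with splitAt≡ m xs
...   | (p , s) = x ∷ p , s

-- The map f, as a list of cycles; a cycle (c₁,...,cₘ) is the list c₁ ∷ ... ∷ cₘ.
-- If π_k = min A:  f(π) = (π_k, π_{k-1}, ..., π₁) f(switch(π_{k+1}⋯π_n)).
-- The first argument is fuel (length of the word suffices).
fCyclesF : ℕ → Word → List (List ℕ)
fCyclesF zero w = []
fCyclesF (suc k) [] = []
fCyclesF (suc k) (x ∷ xs) with splitAt≡ (minL x xs) (x ∷ xs)
... | (p , s) = (minL x xs ∷ reverse p) ∷ fCyclesF k (switch s)

fCycles : Word → List (List ℕ)
fCycles w = fCyclesF (length w) w

cycleFun : List ℕ → ℕ → ℕ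
cycleFun [] x = x
cycleFun (c ∷ cs) x = go (c ∷ cs) x
  where
  go : List ℕ → ℕ → ℕ
  go [] y = y
  go (a ∷ []) y = if a ≡ᵇ y then c else y
  go (a ∷ b ∷ r) y = if a ≡ᵇ y then b else go (b ∷ r) y

-- product of cycles (composition, rightmost applied first)
prodCycles : List (List ℕ) → ℕ → ℕ
prodCycles = foldr (λ c g → cycleFun c ∘ g) id

f : Word → ℕ → ℕ
f w = prodCycles (fCycles w)

iter : ℕ → (ℕ → ℕ) → ℕ → ℕ
iter zero σ x = x
iter (suc k) σ x = σ (iter k σ x)

-- i is the least element of its cycle under σ (σ a permutation of [n]):
-- σ^j(i) ≥ i for all 1 ≤ j ≤ n
isCycleMin : ℕ → (ℕ → ℕ) → ℕ → Bool
isCycleMin n σ i = foldr (λ j b → (i ≤ᵇ iter j σ i) Data.Bool.∧ b) true (range1 n)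
  where import Data.Bool

-- number of cycles of a permutation σ of [n] = number of cycle minima
numCycles : ℕ → (ℕ → ℕ) → ℕ
numCycles n σ = length (filter (λ i → Data.Bool._≟_ (isCycleMin n σ i) true) (range1 n))
  where import Data.Bool

-- min-max subsequence length, with fuel.
-- b = true: next pick the smallest entry; b = false: the largest.
stF : ℕ → Bool → Word → ℕ
stF zero b w = 0
stF (suc k) b [] = 0
stF (suc k) b (x ∷ xs) with splitAt≡ (if b then minL x xs else maxL x xs) (x ∷ xs)
... | (p , []) = 1
... | (p , s@(_ ∷ _)) = suc (stF k (not b) s)

st : Word → ℕ
st w = stF (length w) true w

module Submission where

-- Both sides follow the same recursion. Let m be the minimum of the word w and s the
-- part of w after m. Then f(w) is the cycle from m back to the start of w times
-- f(switch s), while the min-max subsequence of w is m followed by the max-min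
-- subsequence of s. Since switch relabels s by an order-reversing bijection of its
-- entries, the max-min subsequence of s is as long as the min-max subsequence of
-- switch s (stF-antitone), so f produces exactly st(w) cycles (fCyclesF-length).
-- Moreover these cycles are disjoint, cover w and each starts with its least entry
-- (fCyclesF-concat, fCyclesF-minFirst); for such a family the cycle minima of the
-- product are exactly the heads, so numCycles counts the cycles (numCycles-prodCycles).

open import Defs
open import Data.Nat using (ℕ; _≤_)
open import Data.List.Relation.Binary.Permutation.Propositional using (_↭_)
open import Relation.Binary.PropositionalEquality using (_≡_)

open import Data.Bool using (Bool; true; false; not; if_then_else_; _∧_)
import Data.Bool as Bool
open import Data.Bool.Properties using (T-≡; ∧-zeroʳ)
open import Data.Empty using (⊥; ⊥-elim)
open import Data.Nat using (suc; zero; _+_; _<_; _>_; _≤ᵇ_; _≡ᵇ_; _≟_; z≤n; s≤s)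
open import Data.Nat.Properties
  using ( _≤?_; ≡ᵇ⇒≡; ≤-decTotalOrder; ≤-totalOrder; ≤-refl; ≤-reflexive; ≤-trans; ≤-antisym
        ; <-irrefl; <-asym; <-cmp; <⇒≤; <⇒≢; <⇒≱; ≤∧≢⇒<; m≤n⇒m<n∨m≡n; n≤1+n; m≤m+n; m≤n+m
        ; suc-injective; ⊓-sel; ⊔-sel; m⊓n≤m; m⊓n≤n; m≤m⊔n; m≤n⊔m )
open import Data.List using (List; []; _∷_; _++_; concat; filter; foldr; length; map; reverse; upTo; zip)
open import Data.List.Properties
  using ( length-map; length-++; length-reverse; length-upTo; ++-assoc; unfold-reverse
        ; map-cong-local; filter-++; filter-accept; filter-none )
open import Data.List.Membership.Propositional using (_∈_; _∉_)
open import Data.List.Membership.Propositional.Properties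
  using (∈-map⁺; ∈-map⁻; ∈-upTo⁺; ∈-++⁺ˡ; ∈-++⁺ʳ; ∈-∃++; ∈-concat⁺′)
open import Data.List.Relation.Unary.Any as Any using (here; there)
import Data.List.Relation.Unary.Any.Properties as Any
open import Data.List.Relation.Unary.All as All using (All; []; _∷_)
import Data.List.Relation.Unary.All.Properties as All
open import Data.List.Relation.Unary.AllPairs as AllPairs using (AllPairs; []; _∷_)
import Data.List.Relation.Unary.AllPairs.Properties as AllPairs
open import Data.List.Relation.Unary.Unique.Propositional using (Unique)
import Data.List.Relation.Unary.Unique.Propositional.Properties as Unique
open import Data.List.Relation.Binary.Permutation.Propositional
  using (↭-refl; ↭-sym; ↭-trans; ↭⇒↭ₛ; module PermutationReasoning)
import Data.List.Relation.Binary.Permutation.Propositional.Properties as Perm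
import Data.List.Relation.Binary.Permutation.Setoid.Properties as PermSetoid
import Data.List.Relation.Unary.Sorted.TotalOrder.Properties as Sorted
import Data.List.Sort.InsertionSort.Base as InsertionSort
import Data.List.Sort.InsertionSort.Properties as InsertionSortProperties
open import Data.Product using (_×_; _,_; proj₁; proj₂)
open import Data.Sum using (inj₁; inj₂)
open import Function using (flip; _∘_; case_of_)
open import Function.Bundles using (Equivalence; mk⇔)
open import Relation.Binary.Definitions using (tri<; tri≈; tri>)
open import Relation.Binary.PropositionalEquality
  using (refl; sym; trans; cong; cong₂; subst; _≢_; setoid; module ≡-Reasoning)
open import Relation.Nullary.Decidable using (yes; no; dec-true; dec-false; does-⇔)
open import Relation.Unary using (Decidable)

≡⇒≡ᵇ-true : ∀ {m n} → m ≡ n → (m ≡ᵇ n) ≡ true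
≡⇒≡ᵇ-true {m} {n} = dec-true (m ≟ n)

≢⇒≡ᵇ-false : ∀ {m n} → m ≢ n → (m ≡ᵇ n) ≡ false
≢⇒≡ᵇ-false {m} {n} = dec-false (m ≟ n)

≡ᵇ-true⇒≡ : ∀ {m n} → (m ≡ᵇ n) ≡ true → m ≡ n
≡ᵇ-true⇒≡ {m} {n} e = ≡ᵇ⇒≡ m n (Equivalence.from T-≡ e)

≡ᵇ-false⇒≢ : ∀ {m n} → (m ≡ᵇ n) ≡ false → m ≢ n
≡ᵇ-false⇒≢ e m≡n = case trans (sym e) (≡⇒≡ᵇ-true m≡n) of λ ()

≡ᵇ-cong : ∀ {m n m′ n′} → (m ≡ n → m′ ≡ n′) → (m′ ≡ n′ → m ≡ n) → (m ≡ᵇ n) ≡ (m′ ≡ᵇ n′)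
≡ᵇ-cong {m} {n} {m′} {n′} to from = does-⇔ (mk⇔ to from) (m ≟ n) (m′ ≟ n′)

unique-resp-↭ : ∀ {xs ys : List ℕ} → xs ↭ ys → Unique xs → Unique ys
unique-resp-↭ p = PermSetoid.Unique-resp-↭ (setoid ℕ) (↭⇒↭ₛ p)

reverse-AllPairs : ∀ {R : ℕ → ℕ → Set} xs → AllPairs R xs → AllPairs (flip R) (reverse xs)
reverse-AllPairs [] [] = []
reverse-AllPairs (x ∷ xs) (x~xs ∷ p) rewrite unfold-reverse x xs =
  AllPairs.++⁺ (reverse-AllPairs xs p) ([] ∷ [])
    (All.tabulate (λ z∈ → All.lookup x~xs (Any.reverse⁻ z∈) ∷ []))

module Ins = InsertionSort ≤-decTotalOrder
module InsP = InsertionSortProperties ≤-decTotalOrder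

insert≡ : ∀ x ys → insert x ys ≡ Ins.insert x ys
insert≡ x [] = refl
insert≡ x (y ∷ ys) rewrite insert≡ x ys = refl

sort≡ : ∀ xs → sort xs ≡ Ins.sort xs
sort≡ [] = refl
sort≡ (x ∷ xs) rewrite sort≡ xs = insert≡ x (Ins.sort xs)

sort-↭ : ∀ xs → sort xs ↭ xs
sort-↭ xs rewrite sort≡ xs = InsP.sort-↭ xs

sort-increasing : ∀ xs → Unique xs → AllPairs _<_ (sort xs)
sort-increasing xs u = AllPairs.zipWith (λ (x≤y , x≢y) → ≤∧≢⇒< x≤y x≢y)
  (sorted , unique-resp-↭ (↭-sym (sort-↭ xs)) u)
  where
  sorted : AllPairs _≤_ (sort xs)
  sorted rewrite sort≡ xs = Sorted.Sorted⇒AllPairs ≤-totalOrder (InsP.sort-↗ xs)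

relabel : List ℕ → List ℕ → ℕ → ℕ
relabel ks vs = assoc (zip ks vs)

relabel-hit : ∀ k v ks vs → relabel (k ∷ ks) (v ∷ vs) k ≡ v
relabel-hit k v ks vs rewrite ≡⇒≡ᵇ-true {k} refl = refl

relabel-skip : ∀ {k y} v ks vs → k ≢ y → relabel (k ∷ ks) (v ∷ vs) y ≡ relabel ks vs y
relabel-skip _ _ _ k≢y rewrite ≢⇒≡ᵇ-false k≢y = refl

relabel-∈ : ∀ ks vs {y} → length ks ≡ length vs → y ∈ ks → relabel ks vs y ∈ vs
relabel-∈ (k ∷ ks) (v ∷ vs) {y} len y∈ with k ≟ y
... | yes refl = subst (_∈ v ∷ vs) (sym (relabel-hit k v ks vs)) (here refl)
... | no k≢y   = subst (_∈ v ∷ vs) (sym (relabel-skip v ks vs k≢y))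
                   (there (relabel-∈ ks vs (suc-injective len) (Any.tail (k≢y ∘ sym) y∈)))

relabel-antitone : ∀ ks vs {x y} → length ks ≡ length vs → AllPairs _<_ ks → AllPairs _>_ vs →
  x ∈ ks → y ∈ ks → x < y → relabel ks vs y < relabel ks vs x
relabel-antitone (k ∷ ks) (v ∷ vs) _ _ _ (here refl) (here refl) x<y = ⊥-elim (<-irrefl refl x<y)
relabel-antitone (k ∷ ks) (v ∷ vs) len _ (v>vs ∷ _) (here refl) (there y∈) x<y
  rewrite relabel-hit k v ks vs | relabel-skip v ks vs (<⇒≢ x<y) =
  All.lookup v>vs (relabel-∈ ks vs (suc-injective len) y∈)
relabel-antitone (k ∷ ks) (v ∷ vs) _ (k<ks ∷ _) _ (there x∈) (here refl) x<y =
  ⊥-elim (<-asym x<y (All.lookup k<ks x∈))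
relabel-antitone (k ∷ ks) (v ∷ vs) len (k<ks ∷ inc) (_ ∷ dec) (there x∈) (there y∈) x<y
  rewrite relabel-skip v ks vs (<⇒≢ (All.lookup k<ks x∈))
        | relabel-skip v ks vs (<⇒≢ (All.lookup k<ks y∈)) =
  relabel-antitone ks vs (suc-injective len) inc dec x∈ y∈ x<y

relabel-keys : ∀ ks vs → length ks ≡ length vs → Unique ks → map (relabel ks vs) ks ≡ vs
relabel-keys [] [] _ _ = refl
relabel-keys (k ∷ ks) (v ∷ vs) len (k∉ks ∷ u) = cong₂ _∷_ (relabel-hit k v ks vs) (begin
  map (relabel (k ∷ ks) (v ∷ vs)) ks ≡⟨ map-cong-local (All.map (relabel-skip v ks vs) k∉ks) ⟩
  map (relabel ks vs) ks              ≡⟨ relabel-keys ks vs (suc-injective len) u ⟩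
  vs                                  ∎)
  where open ≡-Reasoning

switchMap : List ℕ → ℕ → ℕ
switchMap s = relabel (sort s) (reverse (sort s))

Antitone : (ℕ → ℕ) → List ℕ → Set
Antitone g w = ∀ {x y} → x ∈ w → y ∈ w → x < y → g y < g x

switch-antitone : ∀ s → Unique s → Antitone (switchMap s) s
switch-antitone s u x∈s y∈s =
  relabel-antitone (sort s) (reverse (sort s)) (sym (length-reverse (sort s)))
    increasing (reverse-AllPairs (sort s) increasing) (sorted x∈s) (sorted y∈s)
  where
  increasing : AllPairs _<_ (sort s)
  increasing = sort-increasing s u
  sorted : ∀ {z} → z ∈ s → z ∈ sort s
  sorted = Perm.∈-resp-↭ (↭-sym (sort-↭ s))

switch-↭ : ∀ s → Unique s → switch s ↭ s
switch-↭ s u = begin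
  map g s   ↭⟨ Perm.map⁺ g (↭-sym (sort-↭ s)) ⟩
  map g t   ≡⟨ relabel-keys t (reverse t) (sym (length-reverse t)) (unique-resp-↭ (↭-sym (sort-↭ s)) u) ⟩
  reverse t ↭⟨ Perm.↭-reverse t ⟩
  t         ↭⟨ sort-↭ s ⟩
  s         ∎
  where
  open PermutationReasoning
  t : List ℕ
  t = sort s
  g : ℕ → ℕ
  g = switchMap s

switch-unique : ∀ s → Unique s → Unique (switch s)
switch-unique s u = unique-resp-↭ (↭-sym (switch-↭ s u)) u

minL-∈ : ∀ x xs → minL x xs ∈ x ∷ xs
minL-∈ x [] = here refl
minL-∈ x (y ∷ ys) with ⊓-sel y (minL x ys) | minL-∈ x ys
... | inj₁ e | _       = there (here e)
... | inj₂ e | here e′ = here (trans e e′)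
... | inj₂ e | there m = there (there (subst (_∈ ys) (sym e) m))

maxL-∈ : ∀ x xs → maxL x xs ∈ x ∷ xs
maxL-∈ x [] = here refl
maxL-∈ x (y ∷ ys) with ⊔-sel y (maxL x ys) | maxL-∈ x ys
... | inj₁ e | _       = there (here e)
... | inj₂ e | here e′ = here (trans e e′)
... | inj₂ e | there m = there (there (subst (_∈ ys) (sym e) m))

minL-≤ : ∀ x xs {z} → z ∈ x ∷ xs → minL x xs ≤ z
minL-≤ x [] (here refl) = ≤-refl
minL-≤ x (y ∷ ys) (here refl) = ≤-trans (m⊓n≤n y _) (minL-≤ x ys (here refl))
minL-≤ x (y ∷ ys) (there (here refl)) = m⊓n≤m y _
minL-≤ x (y ∷ ys) (there (there z∈)) = ≤-trans (m⊓n≤n y _) (minL-≤ x ys (there z∈))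

maxL-≥ : ∀ x xs {z} → z ∈ x ∷ xs → z ≤ maxL x xs
maxL-≥ x [] (here refl) = ≤-refl
maxL-≥ x (y ∷ ys) (here refl) = ≤-trans (maxL-≥ x ys (here refl)) (m≤n⊔m y _)
maxL-≥ x (y ∷ ys) (there (here refl)) = m≤m⊔n y _
maxL-≥ x (y ∷ ys) (there (there z∈)) = ≤-trans (maxL-≥ x ys (there z∈)) (m≤n⊔m y _)

antitone-injective : ∀ {g w x y} → Antitone g w → x ∈ w → y ∈ w → g x ≡ g y → x ≡ y
antitone-injective anti x∈ y∈ gx≡gy with <-cmp _ _
... | tri< x<y _ _ = ⊥-elim (<⇒≢ (anti x∈ y∈ x<y) (sym gx≡gy))
... | tri≈ _ x≡y _ = x≡y
... | tri> _ _ y<x = ⊥-elim (<⇒≢ (anti y∈ x∈ y<x) gx≡gy)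

antitone-≤ : ∀ {g w x y} → Antitone g w → x ∈ w → y ∈ w → x ≤ y → g y ≤ g x
antitone-≤ anti x∈ y∈ x≤y with m≤n⇒m<n∨m≡n x≤y
... | inj₁ x<y  = <⇒≤ (anti x∈ y∈ x<y)
... | inj₂ refl = ≤-refl

extreme : Bool → ℕ → List ℕ → ℕ
extreme b x xs = if b then minL x xs else maxL x xs

extreme-∈ : ∀ b x xs → extreme b x xs ∈ x ∷ xs
extreme-∈ true = minL-∈
extreme-∈ false = maxL-∈

extreme-antitone : ∀ g x xs → Antitone g (x ∷ xs) → ∀ b →
  extreme b (g x) (map g xs) ≡ g (extreme (not b) x xs)
extreme-antitone g x xs anti true with ∈-map⁻ g (minL-∈ (g x) (map g xs))
... | z , z∈ , e = ≤-antisym (minL-≤ (g x) (map g xs) (∈-map⁺ g (maxL-∈ x xs)))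
  (subst (g (maxL x xs) ≤_) (sym e) (antitone-≤ anti z∈ (maxL-∈ x xs) (maxL-≥ x xs z∈)))
extreme-antitone g x xs anti false with ∈-map⁻ g (maxL-∈ (g x) (map g xs))
... | z , z∈ , e = ≤-antisym
  (subst (_≤ g (minL x xs)) (sym e) (antitone-≤ anti (minL-∈ x xs) z∈ (minL-≤ x xs z∈)))
  (maxL-≥ (g x) (map g xs) (∈-map⁺ g (minL-∈ x xs)))

prefixBefore suffixAfter : ℕ → Word → Word
prefixBefore m w = proj₁ (splitAt≡ m w)
suffixAfter m w = proj₂ (splitAt≡ m w)

suffixAfter-⊆ : ∀ m w {z} → z ∈ suffixAfter m w → z ∈ w
suffixAfter-⊆ m (x ∷ xs) z∈ with m ≡ᵇ x
... | true  = there z∈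
... | false = there (suffixAfter-⊆ m xs z∈)

suffixAfter-unique : ∀ m w → Unique w → Unique (suffixAfter m w)
suffixAfter-unique m [] u = u
suffixAfter-unique m (x ∷ xs) (_ ∷ u) with m ≡ᵇ x
... | true  = u
... | false = suffixAfter-unique m xs u

prefixBefore-⊆ : ∀ m w {z} → z ∈ prefixBefore m w → z ∈ w
prefixBefore-⊆ m (x ∷ xs) z∈ with m ≡ᵇ x
prefixBefore-⊆ m (x ∷ xs) (here refl) | false = here refl
prefixBefore-⊆ m (x ∷ xs) (there z∈)  | false = there (prefixBefore-⊆ m xs z∈)

prefixBefore-∌ : ∀ m w → m ∉ prefixBefore m w
prefixBefore-∌ m (x ∷ xs) m∈ with m ≡ᵇ x in m≟x
prefixBefore-∌ m (x ∷ xs) (here refl) | false = ≡ᵇ-false⇒≢ {m} m≟x refl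
prefixBefore-∌ m (x ∷ xs) (there m∈)  | false = prefixBefore-∌ m xs m∈

splitAt≡-++ : ∀ m w → m ∈ w → w ≡ prefixBefore m w ++ m ∷ suffixAfter m w
splitAt≡-++ m (x ∷ xs) m∈ with m ≡ᵇ x in m≟x
... | true = cong (_∷ xs) (sym (≡ᵇ-true⇒≡ m≟x))
splitAt≡-++ m (x ∷ xs) (here refl) | false = ⊥-elim (≡ᵇ-false⇒≢ {m} m≟x refl)
splitAt≡-++ m (x ∷ xs) (there m∈)  | false = cong (x ∷_) (splitAt≡-++ m xs m∈)

suffixAfter-shorter : ∀ m x xs → length (suffixAfter m (x ∷ xs)) ≤ length xs
suffixAfter-shorter m x xs with m ≡ᵇ x
suffixAfter-shorter m x xs       | true  = ≤-refl
suffixAfter-shorter m x []       | false = z≤n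
suffixAfter-shorter m x (y ∷ ys) | false = ≤-trans (suffixAfter-shorter m y ys) (n≤1+n _)

suffixAfter-map : ∀ g m w → (∀ {z} → z ∈ w → g m ≡ g z → m ≡ z) →
  suffixAfter (g m) (map g w) ≡ map g (suffixAfter m w)
suffixAfter-map g m [] _ = refl
suffixAfter-map g m (x ∷ xs) inj rewrite ≡ᵇ-cong (inj (here refl)) (cong g) with m ≡ᵇ x
... | true  = refl
... | false = suffixAfter-map g m xs (inj ∘ there)

stStep : ℕ → Bool → Word → ℕ
stStep k b [] = 1
stStep k b (y ∷ ys) = suc (stF k (not b) (y ∷ ys))

stF-step : ∀ k b x xs → stF (suc k) b (x ∷ xs) ≡ stStep k b (suffixAfter (extreme b x xs) (x ∷ xs))
stF-step k b x xs with splitAt≡ (extreme b x xs) (x ∷ xs)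
... | _ , []    = refl
... | _ , _ ∷ _ = refl

stF-antitone : ∀ k b g w → Antitone g w → stF k b (map g w) ≡ stF k (not b) w
stF-antitone zero b g w anti = refl
stF-antitone (suc k) b g [] anti = refl
stF-antitone (suc k) b g (x ∷ xs) anti = begin
  stF (suc k) b (map g (x ∷ xs))
    ≡⟨ stF-step k b (g x) (map g xs) ⟩
  stStep k b (suffixAfter (extreme b (g x) (map g xs)) (map g (x ∷ xs)))
    ≡⟨ cong (λ e → stStep k b (suffixAfter e (map g (x ∷ xs)))) (extreme-antitone g x xs anti b) ⟩
  stStep k b (suffixAfter (g m) (map g (x ∷ xs)))
    ≡⟨ cong (stStep k b) (suffixAfter-map g m (x ∷ xs) (antitone-injective anti (extreme-∈ (not b) x xs))) ⟩
  stStep k b (map g s)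
    ≡⟨ stStep-antitone s (λ y∈ z∈ → anti (suffixAfter-⊆ m (x ∷ xs) y∈) (suffixAfter-⊆ m (x ∷ xs) z∈)) ⟩
  stStep k (not b) s
    ≡⟨ sym (stF-step k (not b) x xs) ⟩
  stF (suc k) (not b) (x ∷ xs) ∎
  where
  open ≡-Reasoning
  m : ℕ
  m = extreme (not b) x xs
  s : Word
  s = suffixAfter m (x ∷ xs)
  stStep-antitone : ∀ s → Antitone g s → stStep k b (map g s) ≡ stStep k (not b) s
  stStep-antitone [] _ = refl
  stStep-antitone (y ∷ ys) anti′ = cong suc (stF-antitone k (not b) g (y ∷ ys) anti′)

fCyclesF-step : ∀ k x xs → let m = minL x xs in
  fCyclesF (suc k) (x ∷ xs) ≡
    (m ∷ reverse (prefixBefore m (x ∷ xs))) ∷ fCyclesF k (switch (suffixAfter m (x ∷ xs)))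
fCyclesF-step k x xs with splitAt≡ (minL x xs) (x ∷ xs)
... | _ , _ = refl

fCyclesF-[] : ∀ k → fCyclesF k [] ≡ []
fCyclesF-[] zero = refl
fCyclesF-[] (suc k) = refl

-- f produces exactly as many cycles as the min-max subsequence has entries: each cycle
-- closes at the current minimum, and switching the remainder turns the next maximum
-- into the next minimum (stF-antitone).
fCyclesF-length : ∀ k w → Unique w → length (fCyclesF k w) ≡ stF k true w
fCyclesF-length zero w u = refl
fCyclesF-length (suc k) [] u = refl
fCyclesF-length (suc k) (x ∷ xs) u = begin
  length (fCyclesF (suc k) (x ∷ xs))     ≡⟨ cong length (fCyclesF-step k x xs) ⟩
  suc (length (fCyclesF k (switch s)))  ≡⟨ remaining s (suffixAfter-unique m (x ∷ xs) u) ⟩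
  stStep k true s                       ≡⟨ sym (stF-step k true x xs) ⟩
  stF (suc k) true (x ∷ xs)             ∎
  where
  open ≡-Reasoning
  m : ℕ
  m = minL x xs
  s : Word
  s = suffixAfter m (x ∷ xs)
  remaining : ∀ s → Unique s → suc (length (fCyclesF k (switch s))) ≡ stStep k true s
  remaining [] _ = cong (suc ∘ length) (fCyclesF-[] k)
  remaining s@(_ ∷ _) u′ = cong suc (trans
    (fCyclesF-length k (switch s) (switch-unique s u′))
    (stF-antitone k true (switchMap s) s (switch-antitone s u′)))

MinFirst : List ℕ → Set
MinFirst [] = ⊥
MinFirst (h ∷ t) = All (h <_) t

-- Every cycle of f starts with its minimum: it starts at the minimum m of the
-- current word and contains only entries before m.
fCyclesF-minFirst : ∀ k w → All MinFirst (fCyclesF k w)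
fCyclesF-minFirst zero w = []
fCyclesF-minFirst (suc k) [] = []
fCyclesF-minFirst (suc k) (x ∷ xs) rewrite fCyclesF-step k x xs =
  All.tabulate above ∷ fCyclesF-minFirst k (switch (suffixAfter m (x ∷ xs)))
  where
  m : ℕ
  m = minL x xs
  above : ∀ {z} → z ∈ reverse (prefixBefore m (x ∷ xs)) → m < z
  above z∈ = let z∈p = Any.reverse⁻ z∈ in
    ≤∧≢⇒< (minL-≤ x xs (prefixBefore-⊆ m (x ∷ xs) z∈p))
          (λ m≡z → prefixBefore-∌ m (x ∷ xs) (subst (_∈ _) (sym m≡z) z∈p))

fCyclesF-concat : ∀ k w → length w ≤ k → Unique w → concat (fCyclesF k w) ↭ w
fCyclesF-concat zero [] _ _ = ↭-refl
fCyclesF-concat (suc k) [] _ _ = ↭-refl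
fCyclesF-concat (suc k) (x ∷ xs) (s≤s len) u rewrite fCyclesF-step k x xs = begin
  (m ∷ reverse p) ++ concat (fCyclesF k (switch s))
    ↭⟨ Perm.++⁺ˡ (m ∷ reverse p) (↭-trans (fCyclesF-concat k (switch s) short (switch-unique s us)) (switch-↭ s us)) ⟩
  m ∷ reverse p ++ s  <⟨ Perm.++⁺ʳ s (Perm.↭-reverse p) ⟩
  m ∷ p ++ s          ↭⟨ Perm.shift m p s ⟨
  p ++ m ∷ s          ≡⟨ splitAt≡-++ m (x ∷ xs) (minL-∈ x xs) ⟨
  x ∷ xs              ∎
  where
  open PermutationReasoning
  m : ℕ
  m = minL x xs
  p : Word
  p = prefixBefore m (x ∷ xs)
  s : Word
  s = suffixAfter m (x ∷ xs)
  us : Unique s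
  us = suffixAfter-unique m (x ∷ xs) u
  short : length (switch s) ≤ k
  short = ≤-trans (≤-reflexive (length-map (switchMap s) s)) (≤-trans (suffixAfter-shorter m x xs) len)

≤⇒≤ᵇ-true : ∀ {m n} → m ≤ n → (m ≤ᵇ n) ≡ true
≤⇒≤ᵇ-true {m} {n} = dec-true (m ≤? n)

>⇒≤ᵇ-false : ∀ {m n} → n < m → (m ≤ᵇ n) ≡ false
>⇒≤ᵇ-false {m} {n} n<m = dec-false (m ≤? n) (<⇒≱ n<m)

allᵇ-true : ∀ (p : ℕ → Bool) js → (∀ j → p j ≡ true) → foldr (λ j b → p j ∧ b) true js ≡ true
allᵇ-true p [] _ = refl
allᵇ-true p (j ∷ js) all-p rewrite all-p j = allᵇ-true p js all-p

allᵇ-false : ∀ (p : ℕ → Bool) js {j} → j ∈ js → p j ≡ false → foldr (λ j b → p j ∧ b) true js ≡ false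
allᵇ-false p (j ∷ js) (here refl) pj rewrite pj = refl
allᵇ-false p (i ∷ js) (there j∈) pj rewrite allᵇ-false p js j∈ pj = ∧-zeroʳ (p i)

range1-unique : ∀ n → Unique (range1 n)
range1-unique n = Unique.map⁺ suc-injective (Unique.upTo⁺ n)

∈-range1 : ∀ {n j} → j < n → suc j ∈ range1 n
∈-range1 j<n = ∈-map⁺ suc (∈-upTo⁺ j<n)

length-range1 : ∀ n → length (range1 n) ≡ n
length-range1 n = trans (length-map suc (upTo n)) (length-upTo n)

unique-++⁻ : ∀ xs {ys : List ℕ} → Unique (xs ++ ys) →
  Unique xs × Unique ys × (∀ {z} → z ∈ xs → z ∉ ys)
unique-++⁻ [] u = [] , u , λ ()
unique-++⁻ (x ∷ xs) (x∉ ∷ u) with unique-++⁻ xs u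
... | uxs , uys , disjoint = All.++⁻ˡ xs x∉ ∷ uxs , uys , λ
  { (here refl) z∈ys → All.lookup x∉ (∈-++⁺ʳ xs z∈ys) refl
  ; (there z∈xs) → disjoint z∈xs }

unique-∉-prefix : ∀ p {x s} → Unique (p ++ x ∷ s) → x ∉ p
unique-∉-prefix p u x∈p = proj₂ (proj₂ (unique-++⁻ p u)) x∈p (here refl)

unique-concat⁻ : ∀ cs {c} → Unique (concat cs) → c ∈ cs → Unique c
unique-concat⁻ (d ∷ cs) u (here refl) = proj₁ (unique-++⁻ d u)
unique-concat⁻ (d ∷ cs) u (there c∈) = unique-concat⁻ cs (proj₁ (proj₂ (unique-++⁻ d u))) c∈

length-∈-concat : ∀ (cs : List (List ℕ)) {c} → c ∈ cs → length c ≤ length (concat cs)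
length-∈-concat (c ∷ cs) (here refl) =
  ≤-trans (m≤m+n (length c) _) (≤-reflexive (sym (length-++ c)))
length-∈-concat (d ∷ cs) (there c∈) =
  ≤-trans (length-∈-concat cs c∈) (≤-trans (m≤n+m _ (length d)) (≤-reflexive (sym (length-++ d))))

cycleFun-skip : ∀ h a L x → h ≢ x → a ≢ x → cycleFun (h ∷ a ∷ L) x ≡ cycleFun (h ∷ L) x
cycleFun-skip h a []      x h≢x a≢x rewrite ≢⇒≡ᵇ-false h≢x | ≢⇒≡ᵇ-false a≢x = refl
cycleFun-skip h a (_ ∷ _) x h≢x a≢x rewrite ≢⇒≡ᵇ-false h≢x | ≢⇒≡ᵇ-false a≢x = refl

cycleFun-∉ : ∀ c x → x ∉ c → cycleFun c x ≡ x
cycleFun-∉ [] x _ = refl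
cycleFun-∉ (h ∷ []) x x∉ rewrite ≢⇒≡ᵇ-false (λ h≡x → x∉ (here (sym h≡x))) = refl
cycleFun-∉ (h ∷ a ∷ L) x x∉ = trans
  (cycleFun-skip h a L x (λ h≡x → x∉ (here (sym h≡x))) (λ a≡x → x∉ (there (here (sym a≡x)))))
  (cycleFun-∉ (h ∷ L) x λ { (here x≡h) → x∉ (here x≡h) ; (there x∈L) → x∉ (there (there x∈L)) })

next : ℕ → List ℕ → ℕ
next h [] = h
next h (y ∷ _) = y

cycleFun-next : ∀ h u x r → x ∉ h ∷ u → cycleFun (h ∷ u ++ x ∷ r) x ≡ next h r
cycleFun-next h [] x [] x∉ rewrite ≢⇒≡ᵇ-false (λ h≡x → x∉ (here (sym h≡x))) | ≡⇒≡ᵇ-true {x} refl = refl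
cycleFun-next h [] x (_ ∷ _) x∉ rewrite ≢⇒≡ᵇ-false (λ h≡x → x∉ (here (sym h≡x))) | ≡⇒≡ᵇ-true {x} refl = refl
cycleFun-next h (a ∷ u) x r x∉ = trans
  (cycleFun-skip h a (u ++ x ∷ r) x (λ h≡x → x∉ (here (sym h≡x))) (λ a≡x → x∉ (there (here (sym a≡x)))))
  (cycleFun-next h u x r λ { (here x≡h) → x∉ (here x≡h) ; (there x∈u) → x∉ (there (there x∈u)) })

cycleFun-∈ : ∀ c x → Unique c → x ∈ c → cycleFun c x ∈ c
cycleFun-∈ (h ∷ []) x _ (here refl) rewrite ≡⇒≡ᵇ-true {h} refl = here refl
cycleFun-∈ (h ∷ a ∷ L) x _ (here refl) rewrite ≡⇒≡ᵇ-true {h} refl = there (here refl)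
cycleFun-∈ (h ∷ t) x uc (there x∈t) with ∈-∃++ x∈t
... | u , r , refl rewrite cycleFun-next h u x r (unique-∉-prefix (h ∷ u) uc) = next-∈ r
  where
  next-∈ : ∀ r → next h r ∈ h ∷ u ++ x ∷ r
  next-∈ [] = here refl
  next-∈ (y ∷ _) = there (∈-++⁺ʳ u (there (here refl)))

prodCycles-∉ : ∀ cs x → x ∉ concat cs → prodCycles cs x ≡ x
prodCycles-∉ [] x _ = refl
prodCycles-∉ (c ∷ cs) x x∉ rewrite prodCycles-∉ cs x (x∉ ∘ ∈-++⁺ʳ c) = cycleFun-∉ c x (x∉ ∘ ∈-++⁺ˡ)

prodCycles-∈ : ∀ cs {c x} → Unique (concat cs) → c ∈ cs → x ∈ c → prodCycles cs x ≡ cycleFun c x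
prodCycles-∈ (d ∷ cs) u (here refl) x∈d with unique-++⁻ d u
... | _ , _ , disjoint = cong (cycleFun d) (prodCycles-∉ cs _ (disjoint x∈d))
prodCycles-∈ (d ∷ cs) {c} {x} u (there c∈) x∈c with unique-++⁻ d u
... | _ , u′ , disjoint rewrite prodCycles-∈ cs u′ c∈ x∈c =
  cycleFun-∉ d (cycleFun c x) λ y∈d →
    disjoint y∈d (∈-concat⁺′ (cycleFun-∈ c x (unique-concat⁻ cs u′ c∈) x∈c) c∈)

iter-shift : ∀ k (σ : ℕ → ℕ) x → iter (suc k) σ x ≡ iter k σ (σ x)
iter-shift zero σ x = refl
iter-shift (suc k) σ x = cong σ (iter-shift k σ x)

module Orbits (cs : List (List ℕ)) (u : Unique (concat cs)) where

  σ : ℕ → ℕ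
  σ = prodCycles cs

  iter-∈ : ∀ j {c x} → c ∈ cs → x ∈ c → iter j σ x ∈ c
  iter-∈ zero c∈ x∈c = x∈c
  iter-∈ (suc j) {c} c∈ x∈c = subst (_∈ c) (sym (prodCycles-∈ cs u c∈ x∈′))
    (cycleFun-∈ c _ (unique-concat⁻ cs u c∈) x∈′)
    where x∈′ = iter-∈ j c∈ x∈c

  σ-next : ∀ h v x r → (h ∷ v ++ x ∷ r) ∈ cs → σ x ≡ next h r
  σ-next h v x r c∈ = trans (prodCycles-∈ cs u c∈ (there (∈-++⁺ʳ v (here refl))))
    (cycleFun-next h v x r (unique-∉-prefix (h ∷ v) (unique-concat⁻ cs u c∈)))

  iter-return : ∀ h v x r → (h ∷ v ++ x ∷ r) ∈ cs → iter (suc (length r)) σ x ≡ h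
  iter-return h v x [] c∈ = σ-next h v x [] c∈
  iter-return h v x (y ∷ r) c∈ = begin
    iter (suc (suc (length r))) σ x  ≡⟨ iter-shift (suc (length r)) σ x ⟩
    iter (suc (length r)) σ (σ x)    ≡⟨ cong (iter (suc (length r)) σ) (σ-next h v x (y ∷ r) c∈) ⟩
    iter (suc (length r)) σ y        ≡⟨ iter-return h (v ++ x ∷ []) y r c∈′ ⟩
    h                                ∎
    where
    open ≡-Reasoning
    c∈′ : (h ∷ (v ++ x ∷ []) ++ y ∷ r) ∈ cs
    c∈′ = subst (_∈ cs) (cong (h ∷_) (sym (++-assoc v (x ∷ []) (y ∷ r)))) c∈

  head-isCycleMin : ∀ n {h t} → (h ∷ t) ∈ cs → MinFirst (h ∷ t) → isCycleMin n σ h ≡ true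
  head-isCycleMin n {h} c∈ h<t = allᵇ-true (λ j → h ≤ᵇ iter j σ h) (range1 n) stays-above
    where
    stays-above : ∀ j → (h ≤ᵇ iter j σ h) ≡ true
    stays-above j with iter-∈ j c∈ (here refl)
    ... | here h′≡h  = ≤⇒≤ᵇ-true (≤-reflexive (sym h′≡h))
    ... | there h′∈t = ≤⇒≤ᵇ-true (<⇒≤ (All.lookup h<t h′∈t))

  -- ... and no other entry is one: within n steps its orbit reaches the smaller head.
  tail-notCycleMin : ∀ n {h t x} → length (concat cs) ≤ n → (h ∷ t) ∈ cs → MinFirst (h ∷ t) →
    x ∈ t → isCycleMin n σ x ≡ false
  tail-notCycleMin n {h} {t} {x} len c∈ h<t x∈t with ∈-∃++ x∈t
  ... | v , r , refl = allᵇ-false (λ j → x ≤ᵇ iter j σ x) (range1 n) (∈-range1 r<n)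
    (trans (cong (x ≤ᵇ_) (iter-return h v x r c∈)) (>⇒≤ᵇ-false (All.lookup h<t x∈t)))
    where
    r<n : length r < n
    r<n = ≤-trans (s≤s (≤-trans (n≤1+n (length r))
                       (≤-trans (m≤n+m _ (length v)) (≤-reflexive (sym (length-++ v))))))
                  (≤-trans (length-∈-concat cs c∈) len)

length-filter-concat : ∀ {P : ℕ → Set} (P? : Decidable P) cs →
  All (λ c → length (filter P? c) ≡ 1) cs → length (filter P? (concat cs)) ≡ length cs
length-filter-concat P? [] [] = refl
length-filter-concat P? (c ∷ cs) (one ∷ ones) = begin
  length (filter P? (c ++ concat cs))                ≡⟨ cong length (filter-++ P? c (concat cs)) ⟩
  length (filter P? c ++ filter P? (concat cs))      ≡⟨ length-++ (filter P? c) ⟩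
  length (filter P? c) + length (filter P? (concat cs)) ≡⟨ cong₂ _+_ one (length-filter-concat P? cs ones) ⟩
  suc (length cs)                                    ∎
  where open ≡-Reasoning

numCycles-prodCycles : ∀ n cs → concat cs ↭ range1 n → All MinFirst cs →
  numCycles n (prodCycles cs) ≡ length cs
numCycles-prodCycles n cs cover minFirst = begin
  length (filter P? (range1 n))   ≡⟨ Perm.↭-length (Perm.filter-↭ P? (↭-sym cover)) ⟩
  length (filter P? (concat cs))  ≡⟨ length-filter-concat P? cs (All.tabulate one-minimum) ⟩
  length cs                       ∎
  where
  open ≡-Reasoning
  u : Unique (concat cs)
  u = unique-resp-↭ (↭-sym cover) (range1-unique n)
  open Orbits cs u
  P? : Decidable (λ i → isCycleMin n σ i ≡ true)
  P? = λ i → isCycleMin n σ i Bool.≟ true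
  len : length (concat cs) ≤ n
  len = ≤-reflexive (trans (Perm.↭-length cover) (length-range1 n))
  one-minimum : ∀ {c} → c ∈ cs → length (filter P? c) ≡ 1
  one-minimum {[]} c∈ = ⊥-elim (All.lookup minFirst c∈)
  one-minimum {h ∷ t} c∈ = cong length (begin
    filter P? (h ∷ t)  ≡⟨ filter-accept P? (head-isCycleMin n c∈ h<t) ⟩
    h ∷ filter P? t    ≡⟨ cong (h ∷_) (filter-none P? (All.tabulate λ x∈t → λ isMin →
                            case trans (sym isMin) (tail-notCycleMin n len c∈ h<t x∈t) of λ ())) ⟩
    h ∷ []             ∎)
    where
    h<t : MinFirst (h ∷ t)
    h<t = All.lookup minFirst c∈

lemma4p1 : ∀ (n : ℕ) → 1 ≤ n → (π : Word) → π ↭ range1 n → UpDown π →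
    numCycles n (f π) ≡ st π
lemma4p1 n _ π π↭[n] _ = begin
  numCycles n (prodCycles (fCycles π))  ≡⟨ numCycles-prodCycles n (fCycles π) cover (fCyclesF-minFirst (length π) π) ⟩
  length (fCycles π)                    ≡⟨ fCyclesF-length (length π) π π-unique ⟩
  st π                                  ∎
  where
  open ≡-Reasoning
  π-unique : Unique π
  π-unique = unique-resp-↭ (↭-sym π↭[n]) (range1-unique n)
  cover : concat (fCycles π) ↭ range1 n
  cover = ↭-trans (fCyclesF-concat (length π) π ≤-refl π-unique) π↭[n]
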